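{- Let $t,n\in\mathbb{N}$ and $v\in V(\mathbf{G}_n)$. Then, deterministically (for every outcome of the random construction), \[ |B_{\mathbf{G}_n}(v,t)| \ge \binom{n+1}{t}.\]
   Context: The random twisted hypercube $\mathbf{G}_n$ is defined recursively: $\mathbf{G}_1=K_2$; for $m\ge2$, take a pair of graphs $(G^{(0)}_{m-1},G^{(1)}_{m-1})$, each distributed as $\mathbf{G}_{m-1}$ (with an arbitrary joint distribution), and add a uniformly random perfect matching $M_m$ between their vertex sets, chosen independently of all other choices; $\mathbf{G}_m$ is the union of the two graphs and $M_m$. For a graph $G$, $v\in V(G)$ and $t\in\mathbb{N}$, $B_G(v,t)=\{w\in V(G): d_G(v,w)\le t\}$ is the closed ball of radius $t$ around $v$. -}

module Defs where

open import Data.Nat using (ℕ; zero; suc)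
open import Data.Bool using (Bool; true; false; not; _∧_; _∨_)
open import Data.Bool.Properties using () renaming (_≟_ to _≟B_)
open import Data.Vec using (Vec; []; _∷_)
open import Data.Vec.Properties using (≡-dec)
open import Data.List using (List; []; _∷_; _++_; map; filter; length)
open import Data.Bool.ListAction using (any)
open import Data.Product using (_×_)
open import Relation.Nullary.Decidable using (⌊_⌋)
open import Relation.Binary.PropositionalEquality using (_≡_)
open import Function.Definitions using (Bijective)

-- Vertices of a graph on 2^n vertices are encoded as bit-vectors of length n.
-- A graph on such a vertex set is given by a Boolean adjacency function.
V : ℕ → Set
V n = Vec Bool n

Adj : ℕ → Set
Adj n = V n → V n → Bool

_==V_ : ∀ {n} → V n → V n → Bool
_==V_ x y = ⌊ ≡-dec _≟B_ x y ⌋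

allV : (n : ℕ) → List (V n)
allV zero = [] ∷ []
allV (suc n) = map (false ∷_) (allV n) ++ map (true ∷_) (allV n)

K2 : Adj 1
K2 (x ∷ []) (y ∷ []) = not (⌊ x ≟B y ⌋)

-- Union of two copies G⁽⁰⁾ (vertices false ∷ x) and G⁽¹⁾ (vertices true ∷ x)
-- together with the perfect matching {(false ∷ x , true ∷ f x)} given by a
-- bijection f between their vertex sets.
join : ∀ {n} → Adj n → Adj n → (V n → V n) → Adj (suc n)
join a0 a1 f (false ∷ x) (false ∷ y) = a0 x y
join a0 a1 f (true ∷ x) (true ∷ y) = a1 x y
join a0 a1 f (false ∷ x) (true ∷ y) = f x ==V y
join a0 a1 f (true ∷ x) (false ∷ y) = f y ==V x

-- TwistedHypercube n a : the graph with adjacency a is a possible outcome of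
-- the random twisted hypercube G_n (n ≥ 1).  Every outcome arises this way
-- (up to relabelling of vertices), for every choice of perfect matchings.
data TwistedHypercube : (n : ℕ) → Adj n → Set where
  base : TwistedHypercube 1 K2
  step : ∀ {n a0 a1} (f : V n → V n) →
         TwistedHypercube n a0 → TwistedHypercube n a1 →
         Bijective _≡_ _≡_ f →
         TwistedHypercube (suc n) (join a0 a1 f)

inBall : ∀ {n} → Adj n → V n → ℕ → V n → Bool
inBall {n} a v zero w = v ==V w
inBall {n} a v (suc t) w =
  inBall a v t w ∨ any (λ u → inBall a v t u ∧ a u w) (allV n)

ballSize : ∀ {n} → Adj n → V n → ℕ → ℕ
ballSize {n} a v t = length (filter (λ w → Data.Bool.T? (inBall a v t w)) (allV n))

module Submission where

-- A ball in the join of two graphs meets both halves: around v = (0, x) it contains the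
-- ball of radius t+1 around x in G⁽⁰⁾ and, through the matching edge at v, the ball of
-- radius t around f x in G⁽¹⁾ (symmetrically for v on the other side).  Induction on n
-- with Pascal's rule C(n+2, t+1) = C(n+1, t+1) + C(n+1, t) then gives the bound; for K₂
-- it is checked directly.

open import Defs
open import Data.Nat using (ℕ; zero; suc; _+_; _≤_; z≤n)
open import Data.Nat.Properties using (≤-refl; +-mono-≤; +-comm; module ≤-Reasoning)
open import Data.Nat.Combinatorics using (_C_; nCk+nC[k+1]≡[n+1]C[k+1])
open import Data.Bool using (Bool; true; false; T; T?)
open import Data.Bool.Properties using (T-∨; T-∧) renaming (_≟_ to _≟B_)
open import Data.Vec using ([]; _∷_)
open import Data.Vec.Properties using (≡-dec)
open import Data.List using (List; []; _∷_; _++_; map; filter; length)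
open import Data.List.Properties using (filter-++; length-++)
open import Data.List.Relation.Unary.Any using (here; satisfied)
open import Data.List.Relation.Unary.Any.Properties using (any⁺; any⁻)
open import Data.List.Membership.Propositional using (_∈_; lose)
open import Data.List.Membership.Propositional.Properties
  using (∈-++⁺ˡ; ∈-++⁺ʳ; ∈-map⁺; ∈-filter⁺; ∈-length)
open import Data.List.Relation.Binary.Sublist.Propositional using (⊆-refl)
open import Data.List.Relation.Binary.Sublist.Propositional.Properties
  using (filter⁺; length-mono-≤)
open import Data.Product using (_×_; _,_; ∃)
open import Data.Sum using (_⊎_; inj₁; inj₂)
open import Function using (_∘_; Equivalence)
open import Relation.Nullary.Decidable using (toWitness; fromWitness)
open import Relation.Binary.PropositionalEquality using (_≡_; refl; sym; cong; cong₂; module ≡-Reasoning)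

open Equivalence using (to; from)

private
  variable
    m n : ℕ

==V-refl : (x : V n) → T (x ==V x)
==V-refl x = fromWitness {a? = ≡-dec _≟B_ x x} refl

==V⇒≡ : {x y : V n} → T (x ==V y) → x ≡ y
==V⇒≡ {x = x} {y} = toWitness {a? = ≡-dec _≟B_ x y}

∈-allV : (x : V n) → x ∈ allV n
∈-allV []          = here refl
∈-allV (false ∷ x) = ∈-++⁺ˡ (∈-map⁺ (false ∷_) (∈-allV x))
∈-allV {suc n} (true ∷ x) = ∈-++⁺ʳ (map (false ∷_) (allV n)) (∈-map⁺ (true ∷_) (∈-allV x))


inBall-suc : (a : Adj n) (v : V n) (t : ℕ) {w : V n} →
             T (inBall a v t w) → T (inBall a v (suc t) w)
inBall-suc a v t w∈B = from T-∨ (inj₁ w∈B)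

inBall-center : (a : Adj n) (v : V n) (t : ℕ) → T (inBall a v t v)
inBall-center a v zero    = ==V-refl v
inBall-center a v (suc t) = inBall-suc a v t (inBall-center a v t)

inBall-snoc : (a : Adj n) (v : V n) (t : ℕ) {u w : V n} →
              T (inBall a v t u) → T (a u w) → T (inBall a v (suc t) w)
inBall-snoc a v t {u} u∈B uw =
  from T-∨ (inj₂ (any⁺ _ (lose (∈-allV u) (from T-∧ (u∈B , uw)))))

inBall-suc⁻ : (a : Adj n) (v : V n) (t : ℕ) {w : V n} → T (inBall a v (suc t) w) →
              T (inBall a v t w) ⊎ ∃ λ u → T (inBall a v t u) × T (a u w)
inBall-suc⁻ {n} a v t w∈B with to T-∨ w∈B
... | inj₁ w∈B′  = inj₁ w∈B′
... | inj₂ viaEdge with satisfied (any⁻ _ (allV n) viaEdge)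
...   | u , u∈B∧uw = inj₂ (u , to T-∧ u∈B∧uw)

inBall-cons : (a : Adj n) {v u : V n} (t : ℕ) {w : V n} →
              T (a v u) → T (inBall a u t w) → T (inBall a v (suc t) w)
inBall-cons a {v} zero vu w∈B with ==V⇒≡ w∈B
... | refl = inBall-snoc a v zero (==V-refl v) vu
inBall-cons a {v} {u} (suc t) vu w∈B with inBall-suc⁻ a u t w∈B
... | inj₁ w∈B′           = inBall-suc a v (suc t) (inBall-cons a t vu w∈B′)
... | inj₂ (w′ , w′∈B , w′w) = inBall-snoc a v (suc t) (inBall-cons a t vu w′∈B) w′w

EdgePreserving : Adj m → Adj n → (V m → V n) → Set
EdgePreserving a b h = ∀ u w → T (a u w) → T (b (h u) (h w))

inBall-map : (a : Adj m) (b : Adj n) (h : V m → V n) → EdgePreserving a b h →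
             ∀ t v w → T (inBall a v t w) → T (inBall b (h v) t (h w))
inBall-map a b h hom zero v w w∈B with ==V⇒≡ w∈B
... | refl = ==V-refl (h v)
inBall-map a b h hom (suc t) v w w∈B with inBall-suc⁻ a v t w∈B
... | inj₁ w∈B′           = inBall-suc b (h v) t (inBall-map a b h hom t v w w∈B′)
... | inj₂ (u , u∈B , uw) = inBall-snoc b (h v) t (inBall-map a b h hom t v u u∈B) (hom u w uw)

count : {A : Set} → (A → Bool) → List A → ℕ
count p xs = length (filter (T? ∘ p) xs)

count-++ : {A : Set} (p : A → Bool) (xs ys : List A) →
           count p (xs ++ ys) ≡ count p xs + count p ys
count-++ p xs ys = begin
  length (filter (T? ∘ p) (xs ++ ys))                  ≡⟨ cong length (filter-++ (T? ∘ p) xs ys) ⟩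
  length (filter (T? ∘ p) xs ++ filter (T? ∘ p) ys)    ≡⟨ length-++ (filter (T? ∘ p) xs) ⟩
  count p xs + count p ys                              ∎
  where open ≡-Reasoning

count-map : {A B : Set} (p : B → Bool) (g : A → B) (xs : List A) →
            count p (map g xs) ≡ count (p ∘ g) xs
count-map p g []       = refl
count-map p g (x ∷ xs) with p (g x)
... | true  = cong suc (count-map p g xs)
... | false = count-map p g xs

count-mono : {A : Set} {p q : A → Bool} → (∀ x → T (p x) → T (q x)) →
             (xs : List A) → count p xs ≤ count q xs
count-mono {p = p} {q} p⇒q xs =
  length-mono-≤ (filter⁺ (T? ∘ p) (T? ∘ q) (λ { refl → p⇒q _ }) (⊆-refl {x = xs}))

count-pos : {A : Set} (p : A → Bool) {x : A} {xs : List A} →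
            x ∈ xs → T (p x) → 1 ≤ count p xs
count-pos p x∈xs px = ∈-length (∈-filter⁺ (T? ∘ p) x∈xs px)

count-allV-suc : (p : V (suc n) → Bool) →
                 count p (allV (suc n)) ≡ count (p ∘ (false ∷_)) (allV n) + count (p ∘ (true ∷_)) (allV n)
count-allV-suc {n} p = begin
  count p (map (false ∷_) (allV n) ++ map (true ∷_) (allV n))
    ≡⟨ count-++ p (map (false ∷_) (allV n)) (map (true ∷_) (allV n)) ⟩
  count p (map (false ∷_) (allV n)) + count p (map (true ∷_) (allV n))
    ≡⟨ cong₂ _+_ (count-map p (false ∷_) (allV n)) (count-map p (true ∷_) (allV n)) ⟩
  count (p ∘ (false ∷_)) (allV n) + count (p ∘ (true ∷_)) (allV n) ∎
  where open ≡-Reasoning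

ballSize-pos : (a : Adj n) (v : V n) (t : ℕ) → 1 ≤ ballSize a v t
ballSize-pos a v t = count-pos (inBall a v t) (∈-allV v) (inBall-center a v t)

ballSize-halves : (a : Adj (suc n)) (v : V (suc n)) (t : ℕ) {p q : V n → Bool} →
                  (∀ w → T (p w) → T (inBall a v t (false ∷ w))) →
                  (∀ w → T (q w) → T (inBall a v t (true ∷ w))) →
                  count p (allV n) + count q (allV n) ≤ ballSize a v t
ballSize-halves {n} a v t p⇒B q⇒B = begin
  count _ (allV n) + count _ (allV n)
    ≤⟨ +-mono-≤ (count-mono p⇒B (allV n)) (count-mono q⇒B (allV n)) ⟩
  count (inBall a v t ∘ (false ∷_)) (allV n) + count (inBall a v t ∘ (true ∷_)) (allV n)
    ≡⟨ sym (count-allV-suc (inBall a v t)) ⟩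
  ballSize a v t ∎
  where open ≤-Reasoning

K2-ballSize : (t : ℕ) (v : V 1) → 2 C t ≤ ballSize K2 v t
K2-ballSize 0                   v            = ballSize-pos K2 v 0
K2-ballSize 1                   (false ∷ []) = ≤-refl
K2-ballSize 1                   (true ∷ [])  = ≤-refl
K2-ballSize 2                   v            = ballSize-pos K2 v 2
K2-ballSize (suc (suc (suc t))) v            = z≤n

module _ (a₀ a₁ : Adj n) (f : V n → V n) where

  private
    J : Adj (suc n)
    J = join a₀ a₁ f

  inBall-join₀ : ∀ t x w → T (inBall a₀ x t w) → T (inBall J (false ∷ x) t (false ∷ w))
  inBall-join₀ = inBall-map a₀ J (false ∷_) (λ _ _ e → e)

  inBall-join₁ : ∀ t x w → T (inBall a₁ x t w) → T (inBall J (true ∷ x) t (true ∷ w))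
  inBall-join₁ = inBall-map a₁ J (true ∷_) (λ _ _ e → e)

  ballSize-join₀ : ∀ t x → ballSize a₀ x (suc t) + ballSize a₁ (f x) t ≤ ballSize J (false ∷ x) (suc t)
  ballSize-join₀ t x = ballSize-halves J (false ∷ x) (suc t)
    (inBall-join₀ (suc t) x)
    (λ w w∈B → inBall-cons J t (==V-refl (f x)) (inBall-join₁ t (f x) w w∈B))

  ballSize-join₁ : ∀ t y → ballSize a₀ y t + ballSize a₁ (f y) (suc t) ≤ ballSize J (true ∷ f y) (suc t)
  ballSize-join₁ t y = ballSize-halves J (true ∷ f y) (suc t)
    (λ w w∈B → inBall-cons J t (==V-refl (f y)) (inBall-join₀ t y w w∈B))
    (inBall-join₁ (suc t) (f y))

ballSize-lower-bound : {a : Adj n} → TwistedHypercube n a → ∀ t v → suc n C t ≤ ballSize a v t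
ballSize-lower-bound base t v = K2-ballSize t v
ballSize-lower-bound {a = a} (step _ _ _ _) zero v = ballSize-pos a v zero
ballSize-lower-bound {suc n} (step {a0 = a₀} {a₁} f G₀ G₁ _) (suc t) (false ∷ x) = begin
  suc (suc n) C suc t                          ≡⟨ sym (nCk+nC[k+1]≡[n+1]C[k+1] (suc n) t) ⟩
  suc n C t + suc n C suc t                    ≡⟨ +-comm (suc n C t) (suc n C suc t) ⟩
  suc n C suc t + suc n C t                    ≤⟨ +-mono-≤ (ballSize-lower-bound G₀ (suc t) x)
                                                           (ballSize-lower-bound G₁ t (f x)) ⟩
  ballSize a₀ x (suc t) + ballSize a₁ (f x) t  ≤⟨ ballSize-join₀ a₀ a₁ f t x ⟩
  ballSize (join a₀ a₁ f) (false ∷ x) (suc t)  ∎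
  where open ≤-Reasoning
ballSize-lower-bound {suc n} (step {a0 = a₀} {a₁} f G₀ G₁ (_ , f-onto)) (suc t) (true ∷ x)
  with f-onto x
... | y , fy≡x with fy≡x refl
... | refl = begin
  suc (suc n) C suc t                          ≡⟨ sym (nCk+nC[k+1]≡[n+1]C[k+1] (suc n) t) ⟩
  suc n C t + suc n C suc t                    ≤⟨ +-mono-≤ (ballSize-lower-bound G₀ t y)
                                                           (ballSize-lower-bound G₁ (suc t) (f y)) ⟩
  ballSize a₀ y t + ballSize a₁ (f y) (suc t)  ≤⟨ ballSize-join₁ a₀ a₁ f t y ⟩
  ballSize (join a₀ a₁ f) (true ∷ f y) (suc t) ∎
  where open ≤-Reasoning

lemma2p2 : (t n : ℕ) (a : Adj n) → TwistedHypercube n a →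
           (v : V n) → (suc n) C t ≤ ballSize a v t
lemma2p2 t n a G v = ballSize-lower-bound G t v
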